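{- Let $\mathcal{T}$ be a planar tiling with symmetry group $G$ and let $H$ be a subgroup of $G$. Consider a coloring of $\mathcal{T}$ in which each element of $H$ permutes the colors. If two $H$-orbits $X_i$ and $X_j$ of tiles of $\mathcal{T}$ share some color (i.e. some color occurs both on a tile of $X_i$ and on a tile of $X_j$), then $X_i$ and $X_j$ have the same set of colors; in particular, $X_i$ and $X_j$ have the same number of colors.
   Context: A planar tiling is a covering of the plane (spherical, Euclidean or hyperbolic) by tiles without gaps or overlaps; its symmetry group $G$ is the group of isometries mapping the tiling to itself. For a tile $t$ and subgroup $H\le G$, the $H$-orbit of $t$ is $Ht=\{ht: h\in H\}$; these are the $H$-orbits of $\mathcal{T}$. A coloring is a surjective map from the set of tiles to a finite set of colors. An element $h$ permutes the colors if for every color $c$, $h$ maps all tiles of color $c$ to tiles of a single color, and the induced map on colors is a permutation. -}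

module Defs where

open import Level using (0ℓ)
open import Algebra.Bundles using (Group)
open import Data.Nat using (ℕ)
open import Data.Fin using (Fin)
open import Data.Product using (Σ; ∃; _×_; _,_)
open import Function.Bundles using (_↔_; Inverse; _⇔_)
open import Function.Definitions using (Surjective)
open import Relation.Binary.PropositionalEquality using (_≡_)

-- Abstract model of a tiling: a type of tiles on which the symmetry
-- group G acts (each g ∈ G is an isometry mapping tiles to tiles).
record TilingAction (G : Group 0ℓ 0ℓ) (Tile : Set) : Set where
  open Group G
  field
    act      : Carrier → Tile → Tile
    act-ε    : ∀ t → act ε t ≡ t
    act-∙    : ∀ g h t → act (g ∙ h) t ≡ act g (act h t)
    act-cong : ∀ {g h} → g ≈ h → ∀ t → act g t ≡ act h t

record Subgroup (G : Group 0ℓ 0ℓ) : Set₁ where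
  open Group G
  field
    InH    : Carrier → Set
    ∈-resp  : ∀ {g h} → g ≈ h → InH g → InH h
    ε∈      : InH ε
    ∙∈      : ∀ {g h} → InH g → InH h → InH (g ∙ h)
    ⁻¹∈     : ∀ {g} → InH g → InH (g ⁻¹)

module _ {G : Group 0ℓ 0ℓ} {Tile : Set} (A : TilingAction G Tile) (H : Subgroup G) where
  open Group G using (Carrier)
  open TilingAction A
  open Subgroup H

  IsColoring : {k : ℕ} → (Tile → Fin k) → Set
  IsColoring col = Surjective _≡_ _≡_ col

  PermutesColors : {k : ℕ} → (Tile → Fin k) → Carrier → Set
  PermutesColors {k} col h =
    Σ (Fin k ↔ Fin k) λ π → ∀ t → col (act h t) ≡ Inverse.to π (col t)

  InOrbit : Tile → Tile → Set
  InOrbit t₀ t = Σ Carrier λ h → InH h × act h t₀ ≡ t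

  ColorOfOrbit : {k : ℕ} → (Tile → Fin k) → Tile → Fin k → Set
  ColorOfOrbit col t₀ c = Σ Tile λ t → InOrbit t₀ t × col t ≡ c

-- The H-orbits partition the tiles, and any h ∈ H maps tiles of equal color to tiles of
-- equal color. If a ∈ H tᵢ and b ∈ H tⱼ have the same color, every tile of H tᵢ is h a for
-- some h ∈ H, and its color is that of h b ∈ H tⱼ; by symmetry the color sets coincide.
module Submission where

open import Defs
open import Level using (0ℓ)
open import Algebra.Bundles using (Group)
open import Data.Nat using (ℕ)
open import Data.Fin using (Fin)
open import Data.Product using (Σ; _×_; _,_; proj₁; proj₂)
open import Function.Bundles using (_⇔_; mk⇔; Inverse)
open import Relation.Binary.PropositionalEquality using (_≡_; refl; sym; trans; cong; module ≡-Reasoning)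

module _ {G : Group 0ℓ 0ℓ} {Tile : Set} (A : TilingAction G Tile) where
  open Group G using (_∙_; ε; _⁻¹; inverseˡ)
  open TilingAction A

  act-⁻¹-cancel : ∀ g t → act (g ⁻¹) (act g t) ≡ t
  act-⁻¹-cancel g t = begin
    act (g ⁻¹) (act g t)  ≡⟨ sym (act-∙ (g ⁻¹) g t) ⟩
    act (g ⁻¹ ∙ g) t      ≡⟨ act-cong (inverseˡ g) t ⟩
    act ε t               ≡⟨ act-ε t ⟩
    t                     ∎
    where open ≡-Reasoning

  module _ (H : Subgroup G) where
    open Subgroup H

    InOrbit-sym : ∀ {s t} → InOrbit A H s t → InOrbit A H t s
    InOrbit-sym {s} (h , h∈ , refl) = h ⁻¹ , ⁻¹∈ h∈ , act-⁻¹-cancel h s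

    InOrbit-trans : ∀ {s t u} → InOrbit A H s t → InOrbit A H t u → InOrbit A H s u
    InOrbit-trans {s} (h , h∈ , refl) (g , g∈ , refl) = _ , ∙∈ g∈ h∈ , act-∙ g h s

    InOrbit-act : ∀ {g} → InH g → ∀ t → InOrbit A H t (act g t)
    InOrbit-act g∈ t = _ , g∈ , refl

    module _ {k : ℕ} (col : Tile → Fin k)
      (perm : ∀ h → InH h → PermutesColors A H col h) where

      act-resp-sameColor : ∀ {g} → InH g → ∀ {a b} → col a ≡ col b → col (act g a) ≡ col (act g b)
      act-resp-sameColor {g} g∈ {a} {b} eq = begin
        col (act g a)        ≡⟨ proj₂ (perm g g∈) a ⟩
        Inverse.to π (col a) ≡⟨ cong (Inverse.to π) eq ⟩
        Inverse.to π (col b) ≡⟨ sym (proj₂ (perm g g∈) b) ⟩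
        col (act g b)        ∎
        where
        open ≡-Reasoning
        π = proj₁ (perm g g∈)

      ColorOfOrbit-transfer : ∀ tᵢ tⱼ
        → Σ (Fin k) (λ c → ColorOfOrbit A H col tᵢ c × ColorOfOrbit A H col tⱼ c)
        → ∀ c → ColorOfOrbit A H col tᵢ c → ColorOfOrbit A H col tⱼ c
      ColorOfOrbit-transfer tᵢ tⱼ (_ , (a , a∈ , ca) , (b , b∈ , cb)) c (t , t∈ , ct)
        with InOrbit-trans (InOrbit-sym a∈) t∈
      ... | g , g∈ , refl =
        act g b , InOrbit-trans b∈ (InOrbit-act g∈ b) , trans same-color ct
        where
        same-color : col (act g b) ≡ col (act g a)
        same-color = act-resp-sameColor g∈ (trans cb (sym ca))

lemma1p4 : {G : Group 0ℓ 0ℓ} {Tile : Set} (A : TilingAction G Tile) (H : Subgroup G)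
    → {k : ℕ} (col : Tile → Fin k) → IsColoring A H col
    → (∀ h → Subgroup.InH H h → PermutesColors A H col h)
    → (tᵢ tⱼ : Tile)
    → Σ (Fin k) (λ c → ColorOfOrbit A H col tᵢ c × ColorOfOrbit A H col tⱼ c)
    → (c : Fin k) → ColorOfOrbit A H col tᵢ c ⇔ ColorOfOrbit A H col tⱼ c
lemma1p4 A H col _ perm tᵢ tⱼ (c₀ , cᵢ , cⱼ) c =
  mk⇔ (ColorOfOrbit-transfer A H col perm tᵢ tⱼ (c₀ , cᵢ , cⱼ) c)
      (ColorOfOrbit-transfer A H col perm tⱼ tᵢ (c₀ , cⱼ , cᵢ) c)
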